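{- Let $G$ be a finite simple graph with exactly two holes $C_1$ and $C_2$. Let $t \in \{1,2\}$ and let $u,v$ be consecutive vertices on $C_t$. If there is no $C_t$-avoiding $(u,v)$-path in $G$, then $G - uv$ (the graph obtained by deleting the edge $uv$) has at most one hole.
   Context: A hole of a graph is an induced subgraph that is a cycle of length at least $4$. For a hole $C$ of $G$, $X_C$ denotes the set of vertices of $G$ adjacent to all vertices of $C$. A walk (resp. path) $W$ is $C$-avoiding if either $W$ has at least $2$ edges and none of its internal vertices lies in $V(C)\cup X_C$, or $W$ has exactly one edge and at least one of its two vertices is not in $V(C)\cup X_C$. -}

module Defs where

open import Data.Nat using (ℕ; zero; suc; _≤_)
open import Data.Fin using (Fin; toℕ; fromℕ; _≟_)
open import Data.Fin.Subset using (Subset; _∈_; _∉_)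
open import Data.Bool using (Bool; true; false; T; _∧_; not)
open import Data.Product using (Σ; ∃; _×_; _,_)
open import Data.Sum using (_⊎_)
open import Relation.Nullary using (¬_)
open import Relation.Nullary.Decidable using (⌊_⌋)
open import Relation.Binary.PropositionalEquality using (_≡_)
open import Function.Definitions using (Injective)
open import Function.Bundles using (_⇔_)

record Graph (n : ℕ) : Set where
  field
    E      : Fin n → Fin n → Bool
    sym    : ∀ x y → E x y ≡ E y x
    irrefl : ∀ x → E x x ≡ false

open Graph public

Adj : ∀ {n} → Graph n → Fin n → Fin n → Set
Adj G x y = T (E G x y)

CycAdj : (k : ℕ) → Fin k → Fin k → Set
CycAdj k i j =
  (toℕ j ≡ suc (toℕ i)) ⊎ (toℕ i ≡ suc (toℕ j))
  ⊎ ((toℕ i ≡ 0 × suc (toℕ j) ≡ k) ⊎ (toℕ j ≡ 0 × suc (toℕ i) ≡ k))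

-- f : Fin k → Fin n is a cyclic enumeration of an induced cycle (k ≥ 4)
-- of G whose vertex set is C.
IsHoleEnum : ∀ {n} → Graph n → Subset n → (k : ℕ) → (Fin k → Fin n) → Set
IsHoleEnum {n} G C k f =
  (4 ≤ k)
  × Injective _≡_ _≡_ f
  × (∀ i j → Adj G (f i) (f j) ⇔ CycAdj k i j)
  × (∀ x → x ∈ C ⇔ (∃ λ i → f i ≡ x))

IsHole : ∀ {n} → Graph n → Subset n → Set
IsHole G C = ∃ λ k → ∃ λ f → IsHoleEnum G C k f

Consecutive : ∀ {n} → Graph n → Subset n → Fin n → Fin n → Set
Consecutive G C u v =
  ∃ λ k → ∃ λ f → IsHoleEnum G C k f ×
    (∃ λ i → ∃ λ j → CycAdj k i j × f i ≡ u × f j ≡ v)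

InX : ∀ {n} → Graph n → Subset n → Fin n → Set
InX G C x = ∀ y → y ∈ C → Adj G x y

InCX : ∀ {n} → Graph n → Subset n → Fin n → Set
InCX G C x = x ∈ C ⊎ InX G C x

IsPath : ∀ {n} → Graph n → Fin n → Fin n → (m : ℕ) → (Fin (suc m) → Fin n) → Set
IsPath G u v m p =
  (1 ≤ m)
  × Injective _≡_ _≡_ p
  × (∀ i j → toℕ j ≡ suc (toℕ i) → Adj G (p i) (p j))
  × p Data.Fin.zero ≡ u
  × p (fromℕ m) ≡ v

Avoiding : ∀ {n} → Graph n → Subset n → (m : ℕ) → (Fin (suc m) → Fin n) → Set
Avoiding G C m p =
  (2 ≤ m × (∀ i → ¬ toℕ i ≡ 0 → ¬ toℕ i ≡ m → ¬ InCX G C (p i)))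
  ⊎ (m ≡ 1 × (¬ InCX G C (p Data.Fin.zero) ⊎ ¬ InCX G C (p (fromℕ m))))

AvoidingPath : ∀ {n} → Graph n → Subset n → Fin n → Fin n → Set
AvoidingPath G C u v = ∃ λ m → ∃ λ p → IsPath G u v m p × Avoiding G C m p

isEdge : ∀ {n} → Fin n → Fin n → Fin n → Fin n → Bool
isEdge u v x y =
  (⌊ x ≟ u ⌋ ∧ ⌊ y ≟ v ⌋) Data.Bool.∨ (⌊ x ≟ v ⌋ ∧ ⌊ y ≟ u ⌋)

deleteEdge : ∀ {n} → Graph n → Fin n → Fin n → Graph n
deleteEdge {n} G u v = record
  { E = λ x y → E G x y ∧ not (isEdge u v x y)
  ; sym = λ x y → symE x y
  ; irrefl = λ x → irr x
  }
  where
  open import Data.Bool.Properties using (∧-zeroˡ)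
  open import Relation.Binary.PropositionalEquality using (cong₂; cong; trans)
  open import Data.Bool.Properties using (∨-comm)
  swap : ∀ x y → isEdge u v x y ≡ isEdge u v y x
  swap x y with x ≟ u | y ≟ v | x ≟ v | y ≟ u
  ... | a | b | c | d = ∨-comm (⌊ a ⌋ ∧ ⌊ b ⌋) (⌊ c ⌋ ∧ ⌊ d ⌋) ▹ fix a b c d
    where
    open import Data.Bool.Properties using (∧-comm)
    _▹_ : ∀ {A : Set} {a b c : A} → a ≡ b → b ≡ c → a ≡ c
    _▹_ = trans
    fix : ∀ a b c d → (⌊ c ⌋ ∧ ⌊ d ⌋) Data.Bool.∨ (⌊ a ⌋ ∧ ⌊ b ⌋)
                    ≡ (⌊ d ⌋ ∧ ⌊ c ⌋) Data.Bool.∨ (⌊ b ⌋ ∧ ⌊ a ⌋)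
    fix a b c d = cong₂ Data.Bool._∨_ (∧-comm ⌊ c ⌋ ⌊ d ⌋) (∧-comm ⌊ a ⌋ ⌊ b ⌋)
  symE : ∀ x y → (E G x y ∧ not (isEdge u v x y)) ≡ (E G y x ∧ not (isEdge u v y x))
  symE x y = cong₂ _∧_ (Graph.sym G x y) (cong not (swap x y))
  irr : ∀ x → (E G x x ∧ not (isEdge u v x x)) ≡ false
  irr x = trans (cong (λ b → b ∧ not (isEdge u v x x)) (Graph.irrefl G x)) (∧-zeroˡ (not (isEdge u v x x)))

-- A hole of G − uv through both u and v is cut by u and v into two arcs, each an
-- induced (u,v)-path of G.  Neither arc is Ct-avoiding, so each has an interior
-- vertex in X_Ct, or an interior vertex on Ct and then (holes being triangle-free)
-- length at least 3.  An X_Ct-vertex on one arc is adjacent to the chosen vertex of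
-- the other arc (X_Ct is a clique, since two non-adjacent x, y ∈ X_Ct span the two
-- further 4-holes x c₀ y c₂ and x c₁ y c₃), which is a chord of the hole.  If both
-- arcs are long they close up with uv into two distinct holes of G, both different
-- from Ct: one hole too many.  So every hole of G − uv misses u or v, hence is a hole
-- of G other than Ct, and there is only one such.

module Submission where

open import Defs hiding (sym)
open import Data.Bool using (true; false; T; not; _∧_)
open import Data.Bool.Properties using (T-∧; T-∨; T-≡)
open import Data.Empty using (⊥; ⊥-elim)
open import Data.Fin as Fin using (Fin; toℕ; fromℕ; fromℕ<; inject≤; opposite)
import Data.Fin.Properties as Finₚ
open import Data.Fin.Subset using (Subset; _∈_)
open import Data.Fin.Patterns using (0F; 1F; 2F; 3F)
open import Data.Fin.Subset.Properties using (_∈?_)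
open import Data.List using (_∷_; [])
open import Data.Nat using (ℕ; zero; suc; _+_; _*_; _∸_; _≤_; _<_; z≤n; s≤s; s≤s⁻¹; NonZero)
open import Data.Nat.DivMod using (_%_; %-distribˡ-+; m%n%n≡m%n; [m+kn]%n≡m%n; m<n⇒m%n≡m; n%n≡0; m%n<n)
open import Data.Nat.Properties
open import Data.Nat.Tactic.RingSolver using (solve)
open import Data.Product using (∃; _×_; _,_; proj₁; proj₂)
import Data.Sum as Sum
open import Data.Sum using (_⊎_; inj₁; inj₂)
open import Data.Unit using (tt)
open import Data.Vec using (tabulate)
open import Data.Vec.Properties using ([]=⇒lookup; lookup⇒[]=; lookup∘tabulate)
open import Function using (_∘_)
open import Function.Bundles using (_⇔_; mk⇔; Equivalence)
open import Relation.Nullary using (¬_; Dec; yes; no)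
open import Relation.Nullary.Decidable
  using (⌊_⌋; True; False; toWitness; fromWitness; toWitnessFalse; T?; _×-dec_; _⊎-dec_)
open import Relation.Binary.PropositionalEquality

open Equivalence using (to; from)

-- Positions on a cycle

-- CycAdj K i j unfolds to CycAdjℕ K (toℕ i) (toℕ j).
CycAdjℕ : ℕ → ℕ → ℕ → Set
CycAdjℕ K i j = (j ≡ suc i) ⊎ (i ≡ suc j) ⊎ ((i ≡ 0 × suc j ≡ K) ⊎ (j ≡ 0 × suc i ≡ K))

CycAdjℕ-sym : ∀ {K i j} → CycAdjℕ K i j → CycAdjℕ K j i
CycAdjℕ-sym (inj₁ e)                = inj₂ (inj₁ e)
CycAdjℕ-sym (inj₂ (inj₁ e))         = inj₁ e
CycAdjℕ-sym (inj₂ (inj₂ (inj₁ p))) = inj₂ (inj₂ (inj₂ p))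
CycAdjℕ-sym (inj₂ (inj₂ (inj₂ p))) = inj₂ (inj₂ (inj₁ p))

CycAdjℕ-zero : ∀ {K j} → CycAdjℕ K 0 j → j ≡ 1 ⊎ suc j ≡ K
CycAdjℕ-zero (inj₁ e)                       = inj₁ e
CycAdjℕ-zero (inj₂ (inj₂ (inj₁ (_ , e))))    = inj₂ e
CycAdjℕ-zero (inj₂ (inj₂ (inj₂ (refl , e)))) = inj₂ e

CycAdjℕ-positive : ∀ {K i j} → 0 < i → 0 < j → CycAdjℕ K i j → j ≡ suc i ⊎ i ≡ suc j
CycAdjℕ-positive _ _ (inj₁ e)                        = inj₁ e
CycAdjℕ-positive _ _ (inj₂ (inj₁ e))                 = inj₂ e
CycAdjℕ-positive (s≤s _) _ (inj₂ (inj₂ (inj₁ (() , _))))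
CycAdjℕ-positive _ (s≤s _) (inj₂ (inj₂ (inj₂ (() , _))))

CycAdjℕ-gap : ∀ {K i j} → 0 < i → suc i < j → ¬ CycAdjℕ K i j
CycAdjℕ-gap {i = i} 0<i i+1<j c with CycAdjℕ-positive 0<i (<-trans 0<i (<-trans (n<1+n i) i+1<j)) c
... | inj₁ refl = <-irrefl refl i+1<j
... | inj₂ refl = <-asym (<-trans (n<1+n _) i+1<j) (n<1+n _)

CycAdjℕ-triangle : ∀ {K b c} → 4 ≤ K → CycAdjℕ K 0 b → CycAdjℕ K 0 c → CycAdjℕ K b c → b ≡ c
CycAdjℕ-triangle 4≤K 0b 0c bc with CycAdjℕ-zero 0b | CycAdjℕ-zero 0c
... | inj₁ refl | inj₁ refl = refl
... | inj₂ e    | inj₂ e′   = suc-injective (trans e (sym e′))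
... | inj₁ refl | inj₂ refl = ⊥-elim (CycAdjℕ-gap (s≤s z≤n) (s≤s⁻¹ 4≤K) bc)
... | inj₂ refl | inj₁ refl = ⊥-elim (CycAdjℕ-gap (s≤s z≤n) (s≤s⁻¹ 4≤K) (CycAdjℕ-sym bc))

CycAdjℕ-far-from-0 : ∀ {K m} → m < K → ¬ m ≡ 0 → ¬ CycAdjℕ K 0 m → 2 ≤ m × 2 + m ≤ K
CycAdjℕ-far-from-0 m<K m≢0 ¬adj =
  ≤∧≢⇒< (≤∧≢⇒< z≤n (m≢0 ∘ sym)) (λ 1≡m → ¬adj (inj₁ (sym 1≡m))) ,
  ≤∧≢⇒< m<K (λ m+1≡K → ¬adj (inj₂ (inj₂ (inj₁ (refl , m+1≡K)))))

SuccMod : ℕ → ℕ → ℕ → Set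
SuccMod k i j = suc i % suc k ≡ j

CycAdj⇒SuccMod : ∀ {k} (i j : Fin (suc k)) → CycAdj (suc k) i j →
  SuccMod k (toℕ i) (toℕ j) ⊎ SuccMod k (toℕ j) (toℕ i)
CycAdj⇒SuccMod {k} i j (inj₁ e) =
  inj₁ (trans (m<n⇒m%n≡m (subst (_< suc k) e (Finₚ.toℕ<n j))) (sym e))
CycAdj⇒SuccMod {k} i j (inj₂ (inj₁ e)) =
  inj₂ (trans (m<n⇒m%n≡m (subst (_< suc k) e (Finₚ.toℕ<n i))) (sym e))
CycAdj⇒SuccMod {k} i j (inj₂ (inj₂ (inj₁ (i≡0 , j+1≡K)))) =
  inj₂ (trans (cong (_% suc k) j+1≡K) (trans (n%n≡0 (suc k)) (sym i≡0)))
CycAdj⇒SuccMod {k} i j (inj₂ (inj₂ (inj₂ (j≡0 , i+1≡K)))) =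
  inj₁ (trans (cong (_% suc k) i+1≡K) (trans (n%n≡0 (suc k)) (sym j≡0)))

suc-%-cases : ∀ k i → i < suc k → suc i % suc k ≡ suc i ⊎ (suc i ≡ suc k × suc i % suc k ≡ 0)
suc-%-cases k i i<K with m≤n⇒m<n∨m≡n (s≤s⁻¹ i<K)
... | inj₁ i<k  = inj₁ (m<n⇒m%n≡m (s≤s i<k))
... | inj₂ refl = inj₂ (refl , n%n≡0 (suc k))

SuccMod⇒CycAdj : ∀ {k} (i j : Fin (suc k)) →
  SuccMod k (toℕ i) (toℕ j) ⊎ SuccMod k (toℕ j) (toℕ i) → CycAdj (suc k) i j
SuccMod⇒CycAdj {k} i j (inj₁ e) with suc-%-cases k (toℕ i) (Finₚ.toℕ<n i)
... | inj₁ r         = inj₁ (trans (sym e) r)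
... | inj₂ (eK , r0) = inj₂ (inj₂ (inj₂ (trans (sym e) r0 , eK)))
SuccMod⇒CycAdj {k} i j (inj₂ e) with suc-%-cases k (toℕ j) (Finₚ.toℕ<n j)
... | inj₁ r         = inj₂ (inj₁ (trans (sym e) r))
... | inj₂ (eK , r0) = inj₂ (inj₂ (inj₁ (trans (sym e) r0 , eK)))

[m+n%o]%o≡[m+n]%o : ∀ m n o .{{_ : NonZero o}} → (m + n % o) % o ≡ (m + n) % o
[m+n%o]%o≡[m+n]%o m n o = begin
  (m + n % o) % o           ≡⟨ %-distribˡ-+ m (n % o) o ⟩
  (m % o + n % o % o) % o   ≡⟨ cong (λ z → (m % o + z) % o) (m%n%n≡m%n n o) ⟩
  (m % o + n % o) % o       ≡⟨ sym (%-distribˡ-+ m n o) ⟩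
  (m + n) % o               ∎
  where open ≡-Reasoning

-- Adding k * a = (k + 1) * a - a undoes the addition of a modulo k + 1.
+-cancelˡ-% : ∀ k a x y → (a + x) % suc k ≡ (a + y) % suc k → x % suc k ≡ y % suc k
+-cancelˡ-% k a x y eq = begin
  x % K                        ≡⟨ sym ([m+kn]%n≡m%n x a K) ⟩
  (x + a * K) % K              ≡⟨ cong (_% K) (shift x) ⟩
  (k * a + (a + x)) % K        ≡⟨ sym ([m+n%o]%o≡[m+n]%o (k * a) (a + x) K) ⟩
  (k * a + (a + x) % K) % K    ≡⟨ cong (λ z → (k * a + z) % K) eq ⟩
  (k * a + (a + y) % K) % K    ≡⟨ [m+n%o]%o≡[m+n]%o (k * a) (a + y) K ⟩
  (k * a + (a + y)) % K        ≡⟨ cong (_% K) (sym (shift y)) ⟩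
  (y + a * K) % K              ≡⟨ [m+kn]%n≡m%n y a K ⟩
  y % K                        ∎
  where
  open ≡-Reasoning
  K = suc k
  shift : ∀ z → z + a * suc k ≡ k * a + (a + z)
  shift z = solve (z ∷ a ∷ k ∷ [])

rotate : ∀ {k} → ℕ → Fin (suc k) → Fin (suc k)
rotate {k} a i = fromℕ< (m%n<n (a + toℕ i) (suc k))

toℕ-rotate : ∀ {k} a (i : Fin (suc k)) → toℕ (rotate a i) ≡ (a + toℕ i) % suc k
toℕ-rotate {k} a i = Finₚ.toℕ-fromℕ< (m%n<n (a + toℕ i) (suc k))

toℕ-rotate-< : ∀ {k} a (i : Fin (suc k)) → a + toℕ i < suc k → toℕ (rotate a i) ≡ a + toℕ i
toℕ-rotate-< a i lt = trans (toℕ-rotate a i) (m<n⇒m%n≡m lt)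

toℕ-rotate-≡ : ∀ {k} a (i : Fin (suc k)) → a + toℕ i ≡ suc k → toℕ (rotate a i) ≡ 0
toℕ-rotate-≡ {k} a i eq = trans (toℕ-rotate a i) (trans (cong (_% suc k) eq) (n%n≡0 (suc k)))

toℕ-rotate-≤ : ∀ {k} a (i : Fin (suc k)) → a + toℕ i ≤ suc k →
  toℕ (rotate a i) ≡ a + toℕ i ⊎ toℕ (rotate a i) ≡ 0
toℕ-rotate-≤ a i a+i≤K = Sum.map (toℕ-rotate-< a i) (toℕ-rotate-≡ a i) (m≤n⇒m<n∨m≡n a+i≤K)

rotate-zero : ∀ {k} (i : Fin (suc k)) → rotate (toℕ i) 0F ≡ i
rotate-zero i = Finₚ.toℕ-injective (trans
  (toℕ-rotate-< (toℕ i) 0F (subst (_< _) (sym (+-identityʳ (toℕ i))) (Finₚ.toℕ<n i)))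
  (+-identityʳ (toℕ i)))

rotate-injective : ∀ {k} a {i j : Fin (suc k)} → rotate a i ≡ rotate a j → i ≡ j
rotate-injective {k} a {i} {j} eq = Finₚ.toℕ-injective (begin
  toℕ i           ≡⟨ sym (m<n⇒m%n≡m (Finₚ.toℕ<n i)) ⟩
  toℕ i % suc k   ≡⟨ +-cancelˡ-% k a (toℕ i) (toℕ j)
                       (trans (sym (toℕ-rotate a i)) (trans (cong toℕ eq) (toℕ-rotate a j))) ⟩
  toℕ j % suc k   ≡⟨ m<n⇒m%n≡m (Finₚ.toℕ<n j) ⟩
  toℕ j           ∎)
  where open ≡-Reasoning

rotate-inverse : ∀ {k} a (i : Fin (suc k)) → rotate a (rotate (k * a) i) ≡ i
rotate-inverse {k} a i = Finₚ.toℕ-injective (begin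
  toℕ (rotate a (rotate (k * a) i))   ≡⟨ toℕ-rotate a _ ⟩
  (a + toℕ (rotate (k * a) i)) % K    ≡⟨ cong (λ z → (a + z) % K) (toℕ-rotate (k * a) i) ⟩
  (a + (k * a + toℕ i) % K) % K       ≡⟨ [m+n%o]%o≡[m+n]%o a _ K ⟩
  (a + (k * a + toℕ i)) % K           ≡⟨ cong (_% K) (regroup (toℕ i)) ⟩
  (toℕ i + a * K) % K                 ≡⟨ [m+kn]%n≡m%n (toℕ i) a K ⟩
  toℕ i % K                           ≡⟨ m<n⇒m%n≡m (Finₚ.toℕ<n i) ⟩
  toℕ i                               ∎)
  where
  open ≡-Reasoning
  K = suc k
  regroup : ∀ z → a + (k * a + z) ≡ z + a * suc k
  regroup z = solve (z ∷ a ∷ k ∷ [])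

SuccMod-rotate : ∀ {k} a (i j : Fin (suc k)) →
  SuccMod k (toℕ (rotate a i)) (toℕ (rotate a j)) ⇔ SuccMod k (toℕ i) (toℕ j)
SuccMod-rotate {k} a i j = mk⇔
  (λ s → trans (+-cancelˡ-% k a (suc (toℕ i)) (toℕ j) (trans (sym succ-rotate) (trans s (toℕ-rotate a j))))
               (m<n⇒m%n≡m (Finₚ.toℕ<n j)))
  (λ s → trans succ-rotate (trans (sym ([m+n%o]%o≡[m+n]%o a (suc (toℕ i)) K))
               (trans (cong (λ z → (a + z) % K) s) (sym (toℕ-rotate a j)))))
  where
  K = suc k
  succ-rotate : suc (toℕ (rotate a i)) % K ≡ (a + suc (toℕ i)) % K
  succ-rotate = begin
    suc (toℕ (rotate a i)) % K   ≡⟨ cong (λ z → suc z % K) (toℕ-rotate a i) ⟩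
    (1 + (a + toℕ i) % K) % K    ≡⟨ [m+n%o]%o≡[m+n]%o 1 (a + toℕ i) K ⟩
    suc (a + toℕ i) % K          ≡⟨ cong (_% K) (sym (+-suc a (toℕ i))) ⟩
    (a + suc (toℕ i)) % K        ∎
    where open ≡-Reasoning

CycAdj-rotate : ∀ {k} a (i j : Fin (suc k)) → CycAdj (suc k) (rotate a i) (rotate a j) ⇔ CycAdj (suc k) i j
CycAdj-rotate a i j = mk⇔
  (λ c → SuccMod⇒CycAdj i j (Sum.map (to (SuccMod-rotate a i j)) (to (SuccMod-rotate a j i))
                                      (CycAdj⇒SuccMod _ _ c)))
  (λ c → SuccMod⇒CycAdj _ _ (Sum.map (from (SuccMod-rotate a i j)) (from (SuccMod-rotate a j i))
                                      (CycAdj⇒SuccMod i j c)))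

IsHoleEnum-rotate : ∀ {n} (G : Graph n) {C k f} → IsHoleEnum G C (suc k) f → ∀ a →
  IsHoleEnum G C (suc k) (f ∘ rotate a)
IsHoleEnum-rotate G {k = k} {f} (4≤K , f-inj , f-adj , f-enum) a =
  4≤K ,
  rotate-injective a ∘ f-inj ,
  (λ i j → mk⇔ (to (CycAdj-rotate a i j) ∘ to (f-adj _ _)) (from (f-adj _ _) ∘ from (CycAdj-rotate a i j))) ,
  λ x → mk⇔ (λ x∈C → let (i , fi≡x) = to (f-enum x) x∈C in
                      rotate (k * a) i , trans (cong f (rotate-inverse a i)) fi≡x)
            (λ (i , e) → from (f-enum x) (rotate a i , e))

-- Edge deletion

Adj-sym : ∀ {n} (G : Graph n) {x y} → Adj G x y → Adj G y x
Adj-sym G {x} {y} = subst T (Graph.sym G x y)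

Adj-irrefl : ∀ {n} (G : Graph n) {x} → ¬ Adj G x x
Adj-irrefl G {x} = subst T (Graph.irrefl G x)

Adj⇒≢ : ∀ {n} (G : Graph n) {x y} → Adj G x y → ¬ x ≡ y
Adj⇒≢ G xy refl = Adj-irrefl G xy

SameEdge : ∀ {n} → Fin n → Fin n → Fin n → Fin n → Set
SameEdge a b x y = (x ≡ a × y ≡ b) ⊎ (x ≡ b × y ≡ a)

SameEdge-swap : ∀ {n} {a b x y : Fin n} → SameEdge a b x y → SameEdge b a x y
SameEdge-swap = Sum.swap

¬SameEdge : ∀ {n} {a b x y : Fin n} → ¬ x ≡ a → ¬ x ≡ b → ¬ SameEdge a b x y
¬SameEdge x≢a _ (inj₁ (x≡a , _)) = x≢a x≡a
¬SameEdge _ x≢b (inj₂ (x≡b , _)) = x≢b x≡b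

SameEdge? : ∀ {n} (a b x y : Fin n) → Dec (SameEdge a b x y)
SameEdge? a b x y = ((x Fin.≟ a) ×-dec (y Fin.≟ b)) ⊎-dec ((x Fin.≟ b) ×-dec (y Fin.≟ a))

record IsEdgeDeletion {n} (G G′ : Graph n) (a b : Fin n) : Set where
  constructor edge-deletion
  field
    Adj′⇔ : ∀ x y → Adj G′ x y ⇔ (Adj G x y × ¬ SameEdge a b x y)

open IsEdgeDeletion using (Adj′⇔)

IsEdgeDeletion-swap : ∀ {n} {G G′ : Graph n} {a b} → IsEdgeDeletion G G′ a b → IsEdgeDeletion G G′ b a
IsEdgeDeletion-swap del = edge-deletion λ x y → mk⇔
  (λ xy → let (xy , ¬ab) = to (Adj′⇔ del x y) xy in xy , ¬ab ∘ SameEdge-swap)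
  (λ (xy , ¬ba) → from (Adj′⇔ del x y) (xy , ¬ba ∘ SameEdge-swap))

T-not : ∀ {b} → T (not b) ⇔ (¬ T b)
T-not {false} = mk⇔ (λ _ ()) (λ _ → tt)
T-not {true}  = mk⇔ (λ ()) (λ ¬t → ¬t tt)

T-isEdge : ∀ {n} (u v x y : Fin n) → T (isEdge u v x y) ⇔ SameEdge u v x y
T-isEdge u v x y = mk⇔
  (Sum.map (to (T-⌊≟⌋∧ x u y v)) (to (T-⌊≟⌋∧ x v y u)) ∘ to T-∨′)
  (from T-∨′ ∘ Sum.map (from (T-⌊≟⌋∧ x u y v)) (from (T-⌊≟⌋∧ x v y u)))
  where
  T-∨′ = T-∨ {⌊ x Fin.≟ u ⌋ ∧ ⌊ y Fin.≟ v ⌋}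
  T-⌊≟⌋∧ : ∀ x a y b → T (⌊ x Fin.≟ a ⌋ ∧ ⌊ y Fin.≟ b ⌋) ⇔ (x ≡ a × y ≡ b)
  T-⌊≟⌋∧ x a y b = mk⇔
    (λ t → let (p , q) = to (T-∧ {⌊ x Fin.≟ a ⌋}) t in toWitness p , toWitness q)
    (λ (p , q) → from (T-∧ {⌊ x Fin.≟ a ⌋}) (fromWitness p , fromWitness q))

deleteEdge-IsEdgeDeletion : ∀ {n} (G : Graph n) u v → IsEdgeDeletion G (deleteEdge G u v) u v
deleteEdge-IsEdgeDeletion G u v = edge-deletion λ x y → mk⇔
  (λ t → let (xy , ¬e) = to (T-∧ {E G x y}) t in xy , to T-not ¬e ∘ from (T-isEdge u v x y))
  (λ (xy , ¬e) → from (T-∧ {E G x y}) (xy , from T-not (¬e ∘ to (T-isEdge u v x y))))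

image : ∀ {n K} → (Fin K → Fin n) → Subset n
image g = tabulate (λ x → ⌊ Finₚ.any? (λ i → g i Fin.≟ x) ⌋)

∈-image⇔ : ∀ {n K} (g : Fin K → Fin n) x → x ∈ image g ⇔ (∃ λ i → g i ≡ x)
∈-image⇔ g x = mk⇔
  (λ x∈ → toWitness (from T-≡ (lookup-image x∈)))
  (λ hit → lookup⇒[]= x _ (trans (lookup∘tabulate bit x) (to T-≡ (fromWitness hit))))
  where
  bit = λ x → ⌊ Finₚ.any? (λ i → g i Fin.≟ x) ⌋
  lookup-image : x ∈ image g → bit x ≡ true
  lookup-image x∈ = trans (sym (lookup∘tabulate bit x)) ([]=⇒lookup x∈)

IsHole-image : ∀ {n} (G : Graph n) K (g : Fin K → Fin n) → 4 ≤ K →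
  (∀ {i j} → g i ≡ g j → i ≡ j) → (∀ i j → Adj G (g i) (g j) ⇔ CycAdj K i j) →
  IsHole G (image g)
IsHole-image G K g 4≤K g-inj g-adj = K , g , 4≤K , g-inj , g-adj , ∈-image⇔ g

-- Holes

module HoleEnum {n} {G : Graph n} {C K f} (hE : IsHoleEnum G C K f) where

  4≤length : 4 ≤ K
  4≤length = proj₁ hE

  injective : ∀ {i j} → f i ≡ f j → i ≡ j
  injective = proj₁ (proj₂ hE)

  adjacent⇔ : ∀ i j → Adj G (f i) (f j) ⇔ CycAdj K i j
  adjacent⇔ = proj₁ (proj₂ (proj₂ hE))

  ∈⇔ : ∀ x → x ∈ C ⇔ (∃ λ i → f i ≡ x)
  ∈⇔ = proj₂ (proj₂ (proj₂ hE))

  position : ∀ {x} → x ∈ C → ∃ λ i → f i ≡ x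
  position = to (∈⇔ _)

  ∈-enum : ∀ i → f i ∈ C
  ∈-enum i = from (∈⇔ (f i)) (i , refl)

  adjacent-at : ∀ {i j x y} → f i ≡ x → f j ≡ y → Adj G x y → CycAdj K i j
  adjacent-at {i} {j} refl refl = to (adjacent⇔ i j)

hole-triangle-free : ∀ {n} (G : Graph n) {C} → IsHole G C → ∀ {x y z} →
  x ∈ C → y ∈ C → z ∈ C → Adj G x y → Adj G y z → Adj G x z → ⊥
hole-triangle-free G (zero , _ , () , _)
hole-triangle-free G (suc k , f , hE) {x} x∈C y∈C z∈C xy yz xz =
  Adj⇒≢ G yz (trans (sym gb≡y) (trans (cong g (Finₚ.toℕ-injective b≡c)) gc≡z))
  where
  module F = HoleEnum {G = G} hE
  a = proj₁ (F.position x∈C)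
  g = f ∘ rotate (toℕ a)
  open HoleEnum {G = G} {f = g} (IsHoleEnum-rotate G hE (toℕ a))
  g0≡x : g 0F ≡ x
  g0≡x = trans (cong f (rotate-zero a)) (proj₂ (F.position x∈C))
  b = proj₁ (position y∈C)
  gb≡y = proj₂ (position y∈C)
  c = proj₁ (position z∈C)
  gc≡z = proj₂ (position z∈C)
  b≡c : toℕ b ≡ toℕ c
  b≡c = CycAdjℕ-triangle F.4≤length
          (adjacent-at g0≡x gb≡y xy) (adjacent-at g0≡x gc≡z xz) (adjacent-at gb≡y gc≡z yz)

CycAdj? : ∀ K (i j : Fin K) → Dec (CycAdj K i j)
CycAdj? K i j = (toℕ j ≟ suc (toℕ i)) ⊎-dec ((toℕ i ≟ suc (toℕ j)) ⊎-dec
  (((toℕ i ≟ 0) ×-dec (suc (toℕ j) ≟ K)) ⊎-dec ((toℕ j ≟ 0) ×-dec (suc (toℕ i) ≟ K))))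

square : ∀ {n} → Fin n → Fin n → Fin n → Fin n → Fin 4 → Fin n
square w₀ w₁ w₂ w₃ 0F = w₀
square w₀ w₁ w₂ w₃ 1F = w₁
square w₀ w₁ w₂ w₃ 2F = w₂
square w₀ w₁ w₂ w₃ 3F = w₃

square-IsHole : ∀ {n} (G : Graph n) {w₀ w₁ w₂ w₃} →
  Adj G w₀ w₁ → Adj G w₁ w₂ → Adj G w₂ w₃ → Adj G w₃ w₀ →
  ¬ Adj G w₀ w₂ → ¬ Adj G w₁ w₃ → ¬ w₀ ≡ w₂ → ¬ w₁ ≡ w₃ →
  IsHole G (image (square w₀ w₁ w₂ w₃))
square-IsHole G {w₀} {w₁} {w₂} {w₃} a₀₁ a₁₂ a₂₃ a₃₀ ¬a₀₂ ¬a₁₃ w₀≢w₂ w₁≢w₃ =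
  IsHole-image G 4 w (s≤s (s≤s (s≤s (s≤s z≤n)))) injective adjacent⇔
  where
  w = square w₀ w₁ w₂ w₃
  ≢ : ∀ {x y} → Adj G x y → ¬ x ≡ y
  ≢ = Adj⇒≢ G
  ≢′ : ∀ {x y} → Adj G x y → ¬ y ≡ x
  ≢′ xy = ≢ xy ∘ sym
  injective : ∀ {i j} → w i ≡ w j → i ≡ j
  injective {0F} {0F} _ = refl
  injective {0F} {1F} e = ⊥-elim (≢ a₀₁ e)
  injective {0F} {2F} e = ⊥-elim (w₀≢w₂ e)
  injective {0F} {3F} e = ⊥-elim (≢′ a₃₀ e)
  injective {1F} {0F} e = ⊥-elim (≢′ a₀₁ e)
  injective {1F} {1F} _ = refl
  injective {1F} {2F} e = ⊥-elim (≢ a₁₂ e)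
  injective {1F} {3F} e = ⊥-elim (w₁≢w₃ e)
  injective {2F} {0F} e = ⊥-elim (w₀≢w₂ (sym e))
  injective {2F} {1F} e = ⊥-elim (≢′ a₁₂ e)
  injective {2F} {2F} _ = refl
  injective {2F} {3F} e = ⊥-elim (≢ a₂₃ e)
  injective {3F} {0F} e = ⊥-elim (≢ a₃₀ e)
  injective {3F} {1F} e = ⊥-elim (w₁≢w₃ (sym e))
  injective {3F} {2F} e = ⊥-elim (≢′ a₂₃ e)
  injective {3F} {3F} _ = refl
  edge : ∀ {x y} {i j : Fin 4} → Adj G x y → True (CycAdj? 4 i j) → Adj G x y ⇔ CycAdj 4 i j
  edge xy c = mk⇔ (λ _ → toWitness c) (λ _ → xy)
  non-edge : ∀ {x y} {i j : Fin 4} → ¬ Adj G x y → False (CycAdj? 4 i j) → Adj G x y ⇔ CycAdj 4 i j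
  non-edge ¬xy c = mk⇔ (⊥-elim ∘ ¬xy) (⊥-elim ∘ toWitnessFalse c)
  adjacent⇔ : ∀ i j → Adj G (w i) (w j) ⇔ CycAdj 4 i j
  adjacent⇔ 0F 0F = non-edge (Adj-irrefl G) tt
  adjacent⇔ 0F 1F = edge a₀₁ tt
  adjacent⇔ 0F 2F = non-edge ¬a₀₂ tt
  adjacent⇔ 0F 3F = edge (Adj-sym G a₃₀) tt
  adjacent⇔ 1F 0F = edge (Adj-sym G a₀₁) tt
  adjacent⇔ 1F 1F = non-edge (Adj-irrefl G) tt
  adjacent⇔ 1F 2F = edge a₁₂ tt
  adjacent⇔ 1F 3F = non-edge ¬a₁₃ tt
  adjacent⇔ 2F 0F = non-edge (¬a₀₂ ∘ Adj-sym G) tt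
  adjacent⇔ 2F 1F = edge (Adj-sym G a₁₂) tt
  adjacent⇔ 2F 2F = non-edge (Adj-irrefl G) tt
  adjacent⇔ 2F 3F = edge a₂₃ tt
  adjacent⇔ 3F 0F = edge a₃₀ tt
  adjacent⇔ 3F 1F = non-edge (¬a₁₃ ∘ Adj-sym G) tt
  adjacent⇔ 3F 2F = edge (Adj-sym G a₂₃) tt
  adjacent⇔ 3F 3F = non-edge (Adj-irrefl G) tt

InX⇒∉ : ∀ {n} (G : Graph n) C {x} → InX G C x → ¬ x ∈ C
InX⇒∉ G C x∈X x∈C = Adj-irrefl G (x∈X _ x∈C)

InX⇒≢ : ∀ {n} (G : Graph n) C {x y} → InX G C x → y ∈ C → ¬ x ≡ y
InX⇒≢ G C x∈X y∈C refl = InX⇒∉ G C x∈X y∈C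

≢third⇒≡ : ∀ {A : Set} {C₁ C₂ X Y Z : A} →
  (X ≡ C₁ ⊎ X ≡ C₂) → (Y ≡ C₁ ⊎ Y ≡ C₂) → (Z ≡ C₁ ⊎ Z ≡ C₂) →
  ¬ X ≡ Z → ¬ Y ≡ Z → X ≡ Y
≢third⇒≡ (inj₁ p) (inj₁ q) _        _   _   = trans p (sym q)
≢third⇒≡ (inj₂ p) (inj₂ q) _        _   _   = trans p (sym q)
≢third⇒≡ (inj₁ p) (inj₂ q) (inj₁ r) X≢Z _   = ⊥-elim (X≢Z (trans p (sym r)))
≢third⇒≡ (inj₁ p) (inj₂ q) (inj₂ r) _   Y≢Z = ⊥-elim (Y≢Z (trans q (sym r)))
≢third⇒≡ (inj₂ p) (inj₁ q) (inj₁ r) _   Y≢Z = ⊥-elim (Y≢Z (trans q (sym r)))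
≢third⇒≡ (inj₂ p) (inj₁ q) (inj₂ r) X≢Z _   = ⊥-elim (X≢Z (trans p (sym r)))

module AtMostTwoHoles {n} (G : Graph n) {C₁ C₂ : Subset n}
  (holes : ∀ C → IsHole G C → C ≡ C₁ ⊎ C ≡ C₂) {Ct : Subset n} (Ct-hole : Ct ≡ C₁ ⊎ Ct ≡ C₂) where

  holes-other-than-Ct-coincide : ∀ {D₁ D₂} → IsHole G D₁ → IsHole G D₂ →
    ¬ D₁ ≡ Ct → ¬ D₂ ≡ Ct → D₁ ≡ D₂
  holes-other-than-Ct-coincide hD₁ hD₂ = ≢third⇒≡ (holes _ hD₁) (holes _ hD₂) Ct-hole

  -- Non-adjacent x, y ∈ X_Ct would give two different 4-holes x c₀ y c₂ and x c₁ y c₃ besides Ct.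
  X-clique : IsHole G Ct → ∀ {x y} → InX G Ct x → InX G Ct y → ¬ x ≡ y → Adj G x y
  X-clique (K , f , hE) {x} {y} x∈X y∈X x≢y with T? (E G x y) | HoleEnum.4≤length {G = G} hE
  ... | yes xy | _ = xy
  ... | no ¬xy | s≤s (s≤s (s≤s (s≤s _))) = ⊥-elim (c₀∉Q₁₃ (subst (f 0F ∈_) Q₀₂≡Q₁₃ c₀∈Q₀₂))
    where
    open HoleEnum {G = G} hE
    non-adjacent : ∀ {i j} → False (CycAdj? K i j) → ¬ Adj G (f i) (f j)
    non-adjacent c = toWitnessFalse c ∘ to (adjacent⇔ _ _)
    Q-hole : ∀ i j → False (CycAdj? K i j) → ¬ i ≡ j → IsHole G (image (square x (f i) y (f j)))
    Q-hole i j c i≢j = square-IsHole G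
      (x∈X _ (∈-enum i)) (Adj-sym G (y∈X _ (∈-enum i))) (y∈X _ (∈-enum j)) (Adj-sym G (x∈X _ (∈-enum j)))
      ¬xy (non-adjacent c) x≢y (i≢j ∘ injective)
    Q≢Ct : ∀ {i j} → ¬ image (square x (f i) y (f j)) ≡ Ct
    Q≢Ct Q≡Ct = InX⇒∉ G Ct x∈X (subst (x ∈_) Q≡Ct (from (∈-image⇔ _ x) (0F , refl)))
    Q₀₂≡Q₁₃ : image (square x (f 0F) y (f 2F)) ≡ image (square x (f 1F) y (f 3F))
    Q₀₂≡Q₁₃ = holes-other-than-Ct-coincide (Q-hole 0F 2F tt (λ ())) (Q-hole 1F 3F tt (λ ())) Q≢Ct Q≢Ct
    c₀∈Q₀₂ : f 0F ∈ image (square x (f 0F) y (f 2F))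
    c₀∈Q₀₂ = from (∈-image⇔ _ _) (1F , refl)
    c₀∉Q₁₃ : ¬ f 0F ∈ image (square x (f 1F) y (f 3F))
    c₀∉Q₁₃ c₀∈Q₁₃ with to (∈-image⇔ _ _) c₀∈Q₁₃
    ... | 0F , x≡c₀ = InX⇒≢ G Ct x∈X (∈-enum 0F) x≡c₀
    ... | 1F , c₁≡c₀ = Finₚ.0≢1+n (injective (sym c₁≡c₀))
    ... | 2F , y≡c₀ = InX⇒≢ G Ct y∈X (∈-enum 0F) y≡c₀
    ... | 3F , c₃≡c₀ = Finₚ.0≢1+n (injective (sym c₃≡c₀))

IsHoleEnum-undelete : ∀ {n} {G G′ : Graph n} {a b} → IsEdgeDeletion G G′ a b → ∀ {D K f} →
  IsHoleEnum G′ D K f → ¬ (a ∈ D × b ∈ D) → IsHoleEnum G D K f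
IsHoleEnum-undelete {G = G} {G′} {a} {b} del {f = f} (4≤K , f-inj , f-adj , f-enum) ¬ab =
  4≤K , f-inj ,
  (λ i j → mk⇔ (to (f-adj i j) ∘ undelete i j) (proj₁ ∘ to (Adj′⇔ del _ _) ∘ from (f-adj i j))) ,
  f-enum
  where
  not-ab : ∀ i j → ¬ SameEdge a b (f i) (f j)
  not-ab i j (inj₁ (fi≡a , fj≡b)) = ¬ab (from (f-enum a) (i , fi≡a) , from (f-enum b) (j , fj≡b))
  not-ab i j (inj₂ (fi≡b , fj≡a)) = ¬ab (from (f-enum a) (j , fj≡a) , from (f-enum b) (i , fi≡b))
  undelete : ∀ i j → Adj G (f i) (f j) → Adj G′ (f i) (f j)
  undelete i j fifj = from (Adj′⇔ del _ _) (fifj , not-ab i j)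

AvoidingPath-sym : ∀ {n} (G : Graph n) {C a b} → AvoidingPath G C a b → AvoidingPath G C b a
AvoidingPath-sym G {C} (m , p , (1≤m , p-inj , p-adj , p0≡a , pm≡b) , avoiding) =
  m , p ∘ opposite ,
  (1≤m , opposite-injective ∘ p-inj , reversed-adj , pm≡b , trans (cong p (Finₚ.opposite-involutive 0F)) p0≡a) ,
  reversed-avoiding avoiding
  where
  opposite-injective : ∀ {i j : Fin (suc m)} → opposite i ≡ opposite j → i ≡ j
  opposite-injective {i} {j} e =
    trans (sym (Finₚ.opposite-involutive i)) (trans (cong opposite e) (Finₚ.opposite-involutive j))
  toℕ-opposite : ∀ (i : Fin (suc m)) → toℕ (opposite i) ≡ m ∸ toℕ i
  toℕ-opposite = Finₚ.opposite-prop
  reversed-adj : ∀ i j → toℕ j ≡ suc (toℕ i) → Adj G (p (opposite i)) (p (opposite j))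
  reversed-adj i j j≡i+1 = Adj-sym G (p-adj (opposite j) (opposite i) (begin
    toℕ (opposite i)       ≡⟨ toℕ-opposite i ⟩
    m ∸ toℕ i              ≡⟨ +-∸-assoc 1 (subst (_≤ m) j≡i+1 (Finₚ.toℕ≤pred[n] j)) ⟩
    suc (m ∸ suc (toℕ i))  ≡⟨ cong (λ z → suc (m ∸ z)) (sym j≡i+1) ⟩
    suc (m ∸ toℕ j)        ≡⟨ cong suc (sym (toℕ-opposite j)) ⟩
    suc (toℕ (opposite j)) ∎))
    where open ≡-Reasoning
  endpoint : ∀ (i : Fin (suc m)) e → toℕ (opposite i) ≡ m ∸ e → e ≤ m → toℕ i ≡ e
  endpoint i e eq e≤m = ∸-cancelˡ-≡ (Finₚ.toℕ≤pred[n] i) e≤m (trans (sym (toℕ-opposite i)) eq)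
  reversed-avoiding : Avoiding G C m p → Avoiding G C m (p ∘ opposite)
  reversed-avoiding (inj₁ (2≤m , interior)) = inj₁ (2≤m , λ i i≢0 i≢m →
    interior (opposite i)
      (λ e → i≢m (endpoint i m (trans e (sym (n∸n≡0 m))) ≤-refl))
      (λ e → i≢0 (endpoint i 0 e z≤n)))
  reversed-avoiding (inj₂ (refl , ends)) = inj₂ (refl , Sum.swap ends)

-- The two arcs into which a and b cut a hole of G′ = G − ab

module Arc {n} {G G′ : Graph n} {a b : Fin n} (del : IsEdgeDeletion G G′ a b) (ab : Adj G a b)
  {Ct : Subset n} (a∈Ct : a ∈ Ct) (b∈Ct : b ∈ Ct) (Ct-isHole : IsHole G Ct)
  (no-path : ¬ AvoidingPath G Ct a b)
  {D : Subset n} {k : ℕ} {h : Fin (suc k) → Fin n} (hE : IsHoleEnum G′ D (suc k) h)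
  (h0≡a : h 0F ≡ a) (M : Fin (suc k)) (hM≡b : h M ≡ b)
  (2≤m : 2 ≤ toℕ M) (m+2≤K : 2 + toℕ M ≤ suc k) where

  open HoleEnum {G = G′} hE

  m : ℕ
  m = toℕ M

  Interior : Fin (suc k) → Set
  Interior I = 0 < toℕ I × toℕ I < m

  Adj′⇒Adj : ∀ {x y} → Adj G′ x y → Adj G x y
  Adj′⇒Adj = proj₁ ∘ to (Adj′⇔ del _ _)

  emb : Fin (suc m) → Fin (suc k)
  emb i = inject≤ i (≤-trans (n≤1+n _) m+2≤K)

  toℕ-emb : ∀ i → toℕ (emb i) ≡ toℕ i
  toℕ-emb i = Finₚ.toℕ-inject≤ i _

  arc : Fin (suc m) → Fin n
  arc = h ∘ emb

  arc-injective : ∀ {i j} → arc i ≡ arc j → i ≡ j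
  arc-injective {i} {j} e =
    Finₚ.toℕ-injective (trans (sym (toℕ-emb i)) (trans (cong toℕ (injective e)) (toℕ-emb j)))

  arc≡a⇔ : ∀ i → arc i ≡ a ⇔ toℕ i ≡ 0
  arc≡a⇔ i = mk⇔
    (λ e → trans (sym (toℕ-emb i)) (cong toℕ (injective (trans e (sym h0≡a)))))
    (λ e → trans (cong h (Finₚ.toℕ-injective (trans (toℕ-emb i) e))) h0≡a)

  arc≡b⇔ : ∀ i → arc i ≡ b ⇔ toℕ i ≡ m
  arc≡b⇔ i = mk⇔
    (λ e → trans (sym (toℕ-emb i)) (cong toℕ (injective (trans e (sym hM≡b)))))
    (λ e → trans (cong h (Finₚ.toℕ-injective (trans (toℕ-emb i) e))) hM≡b)

  ¬wraps : ∀ (i : Fin (suc m)) → ¬ suc (toℕ i) ≡ suc k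
  ¬wraps i e = <-irrefl e (≤-trans (s≤s (s≤s (Finₚ.toℕ≤pred[n] i))) m+2≤K)

  -- Only the deleted edge ab closes the arc into a cycle; all other adjacencies are those of h.
  arc-adjacent⇔ : ∀ i j → Adj G (arc i) (arc j) ⇔ CycAdj (suc m) i j
  arc-adjacent⇔ i j = mk⇔ forward backward
    where
    along : CycAdjℕ (suc k) (toℕ i) (toℕ j) ⇔ CycAdj (suc k) (emb i) (emb j)
    along = mk⇔ (subst₂ (CycAdjℕ (suc k)) (sym (toℕ-emb i)) (sym (toℕ-emb j)))
                (subst₂ (CycAdjℕ (suc k)) (toℕ-emb i) (toℕ-emb j))
    forward : Adj G (arc i) (arc j) → CycAdj (suc m) i j
    forward ij with SameEdge? a b (arc i) (arc j)
    ... | yes (inj₁ (i≡a , j≡b)) =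
      inj₂ (inj₂ (inj₁ (to (arc≡a⇔ i) i≡a , cong suc (to (arc≡b⇔ j) j≡b))))
    ... | yes (inj₂ (i≡b , j≡a)) =
      inj₂ (inj₂ (inj₂ (to (arc≡a⇔ j) j≡a , cong suc (to (arc≡b⇔ i) i≡b))))
    ... | no ¬ab with from along (to (adjacent⇔ _ _) (from (Adj′⇔ del _ _) (ij , ¬ab)))
    ...   | inj₁ e                     = inj₁ e
    ...   | inj₂ (inj₁ e)              = inj₂ (inj₁ e)
    ...   | inj₂ (inj₂ (inj₁ (_ , e))) = ⊥-elim (¬wraps j e)
    ...   | inj₂ (inj₂ (inj₂ (_ , e))) = ⊥-elim (¬wraps i e)
    backward : CycAdj (suc m) i j → Adj G (arc i) (arc j)
    backward (inj₁ e)        = Adj′⇒Adj (from (adjacent⇔ _ _) (to along (inj₁ e)))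
    backward (inj₂ (inj₁ e)) = Adj′⇒Adj (from (adjacent⇔ _ _) (to along (inj₂ (inj₁ e))))
    backward (inj₂ (inj₂ (inj₁ (i≡0 , j+1≡m+1)))) =
      subst₂ (Adj G) (sym (from (arc≡a⇔ i) i≡0)) (sym (from (arc≡b⇔ j) (suc-injective j+1≡m+1))) ab
    backward (inj₂ (inj₂ (inj₂ (j≡0 , i+1≡m+1)))) =
      subst₂ (Adj G) (sym (from (arc≡b⇔ i) (suc-injective i+1≡m+1))) (sym (from (arc≡a⇔ j) j≡0)) (Adj-sym G ab)

  arc-IsHole : 3 ≤ m → IsHole G (image arc)
  arc-IsHole 3≤m = IsHole-image G (suc m) arc (s≤s 3≤m) arc-injective arc-adjacent⇔

  arc-IsPath : IsPath G a b m arc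
  arc-IsPath =
    ≤-trans (s≤s z≤n) 2≤m , arc-injective , (λ i j e → from (arc-adjacent⇔ i j) (inj₁ e)) ,
    from (arc≡a⇔ 0F) refl , from (arc≡b⇔ (fromℕ m)) (Finₚ.toℕ-fromℕ m)

  ∈-arc⇔ : ∀ x → x ∈ image arc ⇔ (∃ λ I → toℕ I ≤ m × h I ≡ x)
  ∈-arc⇔ x = mk⇔
    (λ x∈ → let (i , e) = to (∈-image⇔ arc x) x∈ in
            emb i , subst (_≤ m) (sym (toℕ-emb i)) (Finₚ.toℕ≤pred[n] i) , e)
    (λ (I , I≤m , e) → from (∈-image⇔ arc x)
      (fromℕ< (s≤s I≤m) , trans (cong h (Finₚ.toℕ-injective (trans (toℕ-emb _) (Finₚ.toℕ-fromℕ< _)))) e))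

  data Obstruction : Set where
    X-vertex  : ∀ I → Interior I → InX G Ct (h I) → Obstruction
    Ct-vertex : ∀ I → Interior I → h I ∈ Ct → 3 ≤ m → Obstruction

  -- An interior vertex on Ct forces m ≥ 3: for m = 2 it would close a triangle a (h 1) b inside Ct.
  arc-obstructed : ¬ ¬ Obstruction
  arc-obstructed ¬obstruction = no-path (m , arc , arc-IsPath , inj₁ (2≤m , interior-avoids))
    where
    classify : ∀ I → Interior I → InCX G Ct (h I) → Obstruction
    classify I int (inj₂ hI∈X) = X-vertex I int hI∈X
    classify I int@(0<I , I<m) (inj₁ hI∈Ct) with m ≟ 2
    ... | no m≢2  = Ct-vertex I int hI∈Ct (≤∧≢⇒< 2≤m (m≢2 ∘ sym))
    ... | yes m≡2 = ⊥-elim (hole-triangle-free G Ct-isHole a∈Ct hI∈Ct b∈Ct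
          (subst (λ x → Adj G x (h I)) h0≡a (Adj′⇒Adj (from (adjacent⇔ 0F I) (inj₁ I≡1))))
          (subst (Adj G (h I)) hM≡b (Adj′⇒Adj (from (adjacent⇔ I M) (inj₁ (trans m≡2 (cong suc (sym I≡1)))))))
          ab)
      where
      I≡1 : toℕ I ≡ 1
      I≡1 = ≤-antisym (s≤s⁻¹ (subst (toℕ I <_) m≡2 I<m)) 0<I
    interior-avoids : ∀ i → ¬ toℕ i ≡ 0 → ¬ toℕ i ≡ m → ¬ InCX G Ct (arc i)
    interior-avoids i i≢0 i≢m = ¬obstruction ∘ classify (emb i)
      (subst (0 <_) (sym (toℕ-emb i)) (≤∧≢⇒< z≤n (i≢0 ∘ sym)) ,
       subst (_< m) (sym (toℕ-emb i)) (≤∧≢⇒< (Finₚ.toℕ≤pred[n] i) i≢m))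

module ThroughDeletedEdge {n} (G : Graph n) {C₁ C₂ : Subset n}
  (holes : ∀ C → IsHole G C → C ≡ C₁ ⊎ C ≡ C₂) {Ct : Subset n} (Ct-hole : Ct ≡ C₁ ⊎ Ct ≡ C₂)
  (Ct-isHole : IsHole G Ct) {u v : Fin n} (u∈Ct : u ∈ Ct) (v∈Ct : v ∈ Ct) (uv : Adj G u v)
  (no-path : ¬ AvoidingPath G Ct u v) where

  open AtMostTwoHoles G holes Ct-hole

  G′ : Graph n
  G′ = deleteEdge G u v

  del : IsEdgeDeletion G G′ u v
  del = deleteEdge-IsEdgeDeletion G u v

  InX⇒Adj′ : ∀ {x y} → InX G Ct x → Adj G x y → Adj G′ x y
  InX⇒Adj′ x∈X xy =
    from (Adj′⇔ del _ _) (xy , ¬SameEdge (InX⇒≢ G Ct x∈X u∈Ct) (InX⇒≢ G Ct x∈X v∈Ct))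

  module TwoArcs {D k} {h₁ : Fin (suc k) → Fin n} (h₁E : IsHoleEnum G′ D (suc k) h₁)
    (h₁0≡u : h₁ 0F ≡ u) (M : Fin (suc k)) (h₁M≡v : h₁ M ≡ v)
    (2≤m : 2 ≤ toℕ M) (m+2≤K : 2 + toℕ M ≤ suc k) where

    open HoleEnum {G = G′} h₁E

    m : ℕ
    m = toℕ M

    m≤K : m ≤ suc k
    m≤K = <⇒≤ (Finₚ.toℕ<n M)

    K∸m<K : suc k ∸ m < suc k
    K∸m<K = ∸-monoʳ-< (≤-trans (s≤s z≤n) 2≤m) m≤K

    M′ : Fin (suc k)
    M′ = fromℕ< K∸m<K

    m+m′≡K : m + toℕ M′ ≡ suc k
    m+m′≡K = trans (cong (m +_) (Finₚ.toℕ-fromℕ< K∸m<K)) (m+[n∸m]≡n m≤K)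

    h₂ : Fin (suc k) → Fin n
    h₂ = h₁ ∘ rotate m

    h₂0≡v : h₂ 0F ≡ v
    h₂0≡v = trans (cong h₁ (rotate-zero M)) h₁M≡v

    h₂M′≡u : h₂ M′ ≡ u
    h₂M′≡u = trans (cong h₁ (Finₚ.toℕ-injective (toℕ-rotate-≡ m M′ m+m′≡K))) h₁0≡u

    2≤m′ : 2 ≤ toℕ M′
    2≤m′ = +-cancelˡ-≤ m 2 (toℕ M′) (subst (m + 2 ≤_) (sym m+m′≡K) (subst (_≤ suc k) (+-comm 2 m) m+2≤K))

    m′+2≤K : 2 + toℕ M′ ≤ suc k
    m′+2≤K = subst (2 + toℕ M′ ≤_) m+m′≡K (+-monoˡ-≤ (toℕ M′) 2≤m)

    module A₁ = Arc del uv u∈Ct v∈Ct Ct-isHole no-path h₁E h₁0≡u M h₁M≡v 2≤m m+2≤K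
    module A₂ = Arc (IsEdgeDeletion-swap del) (Adj-sym G uv) v∈Ct u∈Ct Ct-isHole
                  (no-path ∘ AvoidingPath-sym G) (IsHoleEnum-rotate G′ h₁E m)
                  h₂0≡v M′ h₂M′≡u 2≤m′ m′+2≤K

    position₂ : ∀ J → toℕ J < toℕ M′ → toℕ (rotate m J) ≡ m + toℕ J
    position₂ J J<m′ = toℕ-rotate-< m J (subst (m + toℕ J <_) m+m′≡K (+-monoʳ-< m J<m′))

    interiors-apart : ∀ I J → A₁.Interior I → A₂.Interior J → suc (toℕ I) < toℕ (rotate m J)
    interiors-apart I J (_ , I<m) (0<J , J<m′) =
      subst (suc (toℕ I) <_) (sym (position₂ J J<m′)) (≤-<-trans I<m (m<m+n m 0<J))

    interiors-≢ : ∀ I J → A₁.Interior I → A₂.Interior J → ¬ h₁ I ≡ h₂ J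
    interiors-≢ I J int₁ int₂ e =
      <-irrefl (cong toℕ (injective e)) (<-trans (n<1+n _) (interiors-apart I J int₁ int₂))

    interiors-¬Adj′ : ∀ I J → A₁.Interior I → A₂.Interior J → ¬ Adj G′ (h₁ I) (h₂ J)
    interiors-¬Adj′ I J int₁ int₂ =
      CycAdjℕ-gap (proj₁ int₁) (interiors-apart I J int₁ int₂) ∘ to (adjacent⇔ _ _)

    X-interiors-¬Adj : ∀ I J → A₁.Interior I → A₂.Interior J →
      InX G Ct (h₁ I) ⊎ InX G Ct (h₂ J) → ¬ Adj G (h₁ I) (h₂ J)
    X-interiors-¬Adj I J int₁ int₂ (inj₁ x∈X) xy = interiors-¬Adj′ I J int₁ int₂ (InX⇒Adj′ x∈X xy)
    X-interiors-¬Adj I J int₁ int₂ (inj₂ y∈X) xy =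
      interiors-¬Adj′ I J int₁ int₂ (Adj-sym G′ (InX⇒Adj′ y∈X (Adj-sym G xy)))

    interior₂∉arc₁ : ∀ J → A₂.Interior J → ¬ h₂ J ∈ image A₁.arc
    interior₂∉arc₁ J (0<J , J<m′) y∈ with to (A₁.∈-arc⇔ _) y∈
    ... | I , I≤m , e = <-irrefl (cong toℕ (injective e))
      (≤-<-trans I≤m (subst (m <_) (sym (position₂ J J<m′)) (m<m+n m 0<J)))

    interior₁∉arc₂ : ∀ I → A₁.Interior I → ¬ h₁ I ∈ image A₂.arc
    interior₁∉arc₂ I (0<I , I<m) x∈ with to (A₂.∈-arc⇔ _) x∈
    ... | J , J≤m′ , e with toℕ-rotate-≤ m J (subst (m + toℕ J ≤_) m+m′≡K (+-monoʳ-≤ m J≤m′))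
    ...   | inj₁ r≡m+J =
      <-irrefl refl (<-≤-trans I<m (subst (m ≤_) (trans (sym r≡m+J) (cong toℕ (injective e))) (m≤m+n m _)))
    ...   | inj₂ r≡0 = <-irrefl (trans (sym r≡0) (cong toℕ (injective e))) 0<I

    two-long-arcs : ∀ I J → A₁.Interior I → A₂.Interior J → h₁ I ∈ Ct → h₂ J ∈ Ct →
      3 ≤ m → 3 ≤ toℕ M′ → ⊥
    two-long-arcs I J int₁ int₂ x∈Ct y∈Ct 3≤m 3≤m′ =
      interior₁∉arc₂ I int₁
        (subst (h₁ I ∈_) arc₁≡arc₂ (from (A₁.∈-arc⇔ _) (I , <⇒≤ (proj₂ int₁) , refl)))
      where
      arc₁≡arc₂ : image A₁.arc ≡ image A₂.arc
      arc₁≡arc₂ = holes-other-than-Ct-coincide (A₁.arc-IsHole 3≤m) (A₂.arc-IsHole 3≤m′)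
        (λ e → interior₂∉arc₁ J int₂ (subst (h₂ J ∈_) (sym e) y∈Ct))
        (λ e → interior₁∉arc₂ I int₁ (subst (h₁ I ∈_) (sym e) x∈Ct))

    contradiction : ⊥
    contradiction = A₁.arc-obstructed λ o₁ → A₂.arc-obstructed λ o₂ → clash o₁ o₂
      where
      clash : A₁.Obstruction → A₂.Obstruction → ⊥
      clash (A₁.X-vertex I i x∈X) (A₂.X-vertex J j y∈X) =
        X-interiors-¬Adj I J i j (inj₁ x∈X) (X-clique Ct-isHole x∈X y∈X (interiors-≢ I J i j))
      clash (A₁.X-vertex I i x∈X) (A₂.Ct-vertex J j y∈Ct _) =
        X-interiors-¬Adj I J i j (inj₁ x∈X) (x∈X _ y∈Ct)
      clash (A₁.Ct-vertex I i x∈Ct _) (A₂.X-vertex J j y∈X) =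
        X-interiors-¬Adj I J i j (inj₂ y∈X) (Adj-sym G (y∈X _ x∈Ct))
      clash (A₁.Ct-vertex I i x∈Ct 3≤m) (A₂.Ct-vertex J j y∈Ct 3≤m′) =
        two-long-arcs I J i j x∈Ct y∈Ct 3≤m 3≤m′

  no-hole-through-uv : ∀ {D K h} → IsHoleEnum G′ D K h → u ∈ D → v ∈ D → ⊥
  no-hole-through-uv {K = zero} (() , _)
  no-hole-through-uv {K = suc k} {h} hE u∈D v∈D =
    TwoArcs.contradiction h₁E h₁0≡u M h₁M≡v (proj₁ M-far) (proj₂ M-far)
    where
    a = proj₁ (HoleEnum.position {G = G′} hE u∈D)
    h₁ = h ∘ rotate (toℕ a)
    h₁E = IsHoleEnum-rotate G′ hE (toℕ a)
    h₁0≡u : h₁ 0F ≡ u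
    h₁0≡u = trans (cong h (rotate-zero a)) (proj₂ (HoleEnum.position {G = G′} hE u∈D))
    open HoleEnum {G = G′} h₁E
    M = proj₁ (position v∈D)
    h₁M≡v = proj₂ (position v∈D)
    M-far : 2 ≤ toℕ M × 2 + toℕ M ≤ suc k
    M-far = CycAdjℕ-far-from-0 (Finₚ.toℕ<n M)
      (λ M≡0 → Adj⇒≢ G uv (trans (sym h₁0≡u) (trans (cong h₁ (sym (Finₚ.toℕ-injective M≡0))) h₁M≡v)))
      (λ adj → proj₂ (to (Adj′⇔ del u v) (subst₂ (Adj G′) h₁0≡u h₁M≡v (from (adjacent⇔ 0F M) adj)))
                     (inj₁ (refl , refl)))

  hole-of-G′ : ∀ {D} → IsHole G′ D → IsHole G D × ¬ D ≡ Ct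
  hole-of-G′ {D} (K , h , hE) = undeleted , λ { refl → no-hole-through-uv hE u∈Ct v∈Ct }
    where
    undeleted : IsHole G D
    undeleted with (u ∈? D) ×-dec (v ∈? D)
    ... | yes (u∈D , v∈D) = ⊥-elim (no-hole-through-uv hE u∈D v∈D)
    ... | no ¬uv = K , h , IsHoleEnum-undelete del hE ¬uv

lemma12 : ∀ {n} (G : Graph n) (C₁ C₂ : Subset n) →
    IsHole G C₁ → IsHole G C₂ → ¬ C₁ ≡ C₂ →
    (∀ C → IsHole G C → C ≡ C₁ ⊎ C ≡ C₂) →
    ∀ (Ct : Subset n) → (Ct ≡ C₁ ⊎ Ct ≡ C₂) →
    ∀ (u v : Fin n) → Consecutive G Ct u v →
    ¬ AvoidingPath G Ct u v →
    ∀ (D₁ D₂ : Subset n) →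
      IsHole (deleteEdge G u v) D₁ → IsHole (deleteEdge G u v) D₂ → D₁ ≡ D₂
lemma12 G C₁ C₂ _ _ _ holes Ct Ct-hole u v (K , f , fE , i , j , ij , fi≡u , fj≡v) no-path D₁ D₂ hD₁ hD₂ =
  holes-other-than-Ct-coincide (proj₁ (hole-of-G′ hD₁)) (proj₁ (hole-of-G′ hD₂))
    (proj₂ (hole-of-G′ hD₁)) (proj₂ (hole-of-G′ hD₂))
  where
  open HoleEnum {G = G} fE
  open AtMostTwoHoles G holes Ct-hole
  open ThroughDeletedEdge G holes Ct-hole (K , f , fE)
    (subst (_∈ Ct) fi≡u (∈-enum i)) (subst (_∈ Ct) fj≡v (∈-enum j))
    (subst₂ (Adj G) fi≡u fj≡v (from (adjacent⇔ i j) ij)) no-path
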